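{- Let $q$ be a prime power and let $S,\bar S\subseteq\mathbb{F}_q$ with $|S|=|\bar S|$. Let $f:\mathbb{F}_q\to\mathbb{F}_q$, $g:S\to\bar S$, $\lambda:\mathbb{F}_q\to S$ and $\bar\lambda:\mathbb{F}_q\to\bar S$ be maps such that $\lambda$ and $\bar\lambda$ are surjective and $\bar\lambda(f(x))=g(\lambda(x))$ for all $x\in\mathbb{F}_q$. Let $f_1(x)$ be a polynomial over $\mathbb{F}_q$ and $h:S\to\mathbb{F}_q$ a map such that $f(x)=f_1(x)+h(\lambda(x))$ and $f$ is a permutation of $\mathbb{F}_q$. Suppose there exist polynomials $\phi(x),\bar\phi(x)$ over $\mathbb{F}_q$ such that $\Psi(x):=\phi(f_1(x))+\bar\phi(\lambda(x))$ permutes $\mathbb{F}_q$. Then, with $g^{ -1}:\bar S\to S$ the inverse of $g$ (which is a bijection under these hypotheses) and $\Psi^{ -1}$ the compositional inverse of $\Psi$, the compositional inverse of $f$ over $\mathbb{F}_q$ is $$f^{ -1}(x)=\Psi^{ -1}\Big(\phi\big(x-h(g^{ -1}(\bar\lambda(x)))\big)+\bar\phi\big(g^{ -1}(\bar\lambda(x))\big)\Big).$$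
   Context: The compositional inverse of a permutation $F$ of $\mathbb{F}_q$ is the unique map $F^{ -1}$ on $\mathbb{F}_q$ with $F(F^{ -1}(x))=F^{ -1}(F(x))=x$ for all $x\in\mathbb{F}_q$. -}

module Defs where

open import Data.Nat using (ℕ; suc; _^_)
open import Data.Nat.Primality using (Prime)
open import Data.Fin using (Fin)
open import Data.Bool using (T)
open import Data.Vec using (lookup)
open import Data.Fin.Subset using (Subset)
open import Data.List using (List; []; _∷_)
open import Data.Product using (Σ; ∃; ∃₂; _×_)
open import Relation.Binary.PropositionalEquality using (_≡_; _≢_)
open import Algebra.Structures using (IsCommutativeRing)

IsPrimePower : ℕ → Set
IsPrimePower q = ∃₂ λ p k → Prime p × q ≡ p ^ suc k

-- A finite field with q elements, realised on the carrier Fin q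
-- (any finite field of order q is isomorphic to such a structure),
-- with propositional equality.
record FiniteField (q : ℕ) : Set where
  infixl 6 _+_ _-_
  infixl 7 _*_
  field
    _+_ _*_ : Fin q → Fin q → Fin q
    -_ : Fin q → Fin q
    0# 1# : Fin q
    isCommutativeRing : IsCommutativeRing _≡_ _+_ _*_ -_ 0# 1#
    0≢1 : 0# ≢ 1#
    inverse : ∀ x → x ≢ 0# → Σ (Fin q) λ y → x * y ≡ 1#

  _-_ : Fin q → Fin q → Fin q
  x - y = x + (- y)

  -- polynomials over F_q as coefficient lists (constant term first)
  Poly : Set
  Poly = List (Fin q)

  eval : Poly → Fin q → Fin q
  eval [] x = 0#
  eval (c ∷ cs) x = c + x * eval cs x

Elem : ∀ {q} → Subset q → Set
Elem {q} S = Σ (Fin q) λ x → T (lookup S x)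

{-# OPTIONS --safe #-}
-- g is onto because λ̄ ∘ f = g ∘ λ' and both λ̄ and f are onto, and an onto map
-- between finite sets of the same size is a bijection. For the inverse, the
-- commuting square lets one read λ'(x) off f(x) as g⁻¹(λ̄(f(x))); then
-- f₁(x) = f(x) − h(λ'(x)), so Ψ(x) is a function of f(x) and Ψ⁻¹ returns x.
-- This makes the given formula a left inverse of f, and a left inverse of a
-- surjection is a two-sided inverse.
module Submission where

open import Defs
open import Data.Nat using (ℕ; suc)
open import Data.Nat.Properties using (1+n≰n)
open import Data.Fin using (Fin; zero; suc; punchOut; _≟_)
open import Data.Fin.Properties using (any?; injective⇒≤; punchOut-injective)
open import Data.Fin.Subset using (Subset; ∣_∣; inside; outside)
open import Data.Product using (_×_; _,_; proj₁; proj₂)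
open import Data.Unit using (tt)
open import Data.Vec using (_∷_)
open import Algebra.Bundles using (CommutativeRing)
import Algebra.Properties.Group as GroupProperties
open import Function.Base using (_∘_)
open import Function.Bundles using (_↔_; Inverse; Injection; mk↔ₛ′)
open import Function.Properties.Inverse using (↔⇒↣)
open import Function.Consequences.Propositional
  using (strictlySurjective⇒surjective; surjective⇒strictlySurjective)
open import Function.Definitions
  using (Surjective; Bijective; Injective; StrictlySurjective; StrictlyInverseʳ; StrictlyInverseˡ)
open import Relation.Binary.PropositionalEquality
  using (_≡_; _≢_; refl; sym; trans; cong; subst; module ≡-Reasoning)
open import Relation.Nullary using (yes; no; contradiction)

open ≡-Reasoning

strictlyInverseʳ⇒strictlyInverseˡ : ∀ {a b} {A : Set a} {B : Set b} {f : A → B} {f⁻¹ : B → A} →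
  StrictlySurjective _≡_ f → StrictlyInverseʳ _≡_ f f⁻¹ → StrictlyInverseˡ _≡_ f f⁻¹
strictlyInverseʳ⇒strictlyInverseˡ {f = f} f-surj f⁻¹∘f≗id y with x , refl ← f-surj y =
  cong f (f⁻¹∘f≗id x)

injective⇒strictlySurjective : ∀ {n} {f : Fin n → Fin n} →
  Injective _≡_ _≡_ f → StrictlySurjective _≡_ f
injective⇒strictlySurjective {suc n} {f} f-injective y with any? (λ x → f x ≟ y)
... | yes hit = hit
... | no miss = contradiction (injective⇒≤ punchOut∘f-injective) 1+n≰n
  where
  -- Missing y, f would inject Fin (suc n) into Fin (suc n) ∖ {y} ≅ Fin n.
  y≢f : ∀ x → y ≢ f x
  y≢f x y≡fx = miss (x , sym y≡fx)

  punchOut∘f-injective : Injective _≡_ _≡_ (λ x → punchOut (y≢f x))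
  punchOut∘f-injective eq = f-injective (punchOut-injective (y≢f _) (y≢f _) eq)

strictlySurjective⇒injective : ∀ {n} {f : Fin n → Fin n} →
  StrictlySurjective _≡_ f → Injective _≡_ _≡_ f
strictlySurjective⇒injective {n} {f} f-surj {x} {x′} fx≡fx′ = begin
  x          ≡⟨ s∘f≗id x ⟨
  s (f x)    ≡⟨ cong s fx≡fx′ ⟩
  s (f x′)   ≡⟨ s∘f≗id x′ ⟩
  x′         ∎
  where
  s : Fin n → Fin n
  s = proj₁ ∘ f-surj

  s-injective : Injective _≡_ _≡_ s
  s-injective {y} {y′} sy≡sy′ = trans (sym (proj₂ (f-surj y))) (trans (cong f sy≡sy′) (proj₂ (f-surj y′)))

  s∘f≗id : StrictlyInverseˡ _≡_ s f
  s∘f≗id = strictlyInverseʳ⇒strictlyInverseˡ (injective⇒strictlySurjective s-injective) (proj₂ ∘ f-surj)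

strictlySurjective⇒injective-↔Fin : ∀ {a b} {A : Set a} {B : Set b} {n} →
  A ↔ Fin n → B ↔ Fin n → {g : A → B} → StrictlySurjective _≡_ g → Injective _≡_ _≡_ g
strictlySurjective⇒injective-↔Fin {n = n} A↔Fin B↔Fin {g} g-surj {x} {x′} gx≡gx′ =
  Injection.injective (↔⇒↣ A↔Fin) (G-injective (begin
    G (A.to x)    ≡⟨ G∘to≗to∘g x ⟩
    B.to (g x)    ≡⟨ cong B.to gx≡gx′ ⟩
    B.to (g x′)   ≡⟨ G∘to≗to∘g x′ ⟨
    G (A.to x′)   ∎))
  where
  module A = Inverse A↔Fin
  module B = Inverse B↔Fin

  G : Fin n → Fin n
  G = B.to ∘ g ∘ A.from

  G∘to≗to∘g : ∀ x → G (A.to x) ≡ B.to (g x)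
  G∘to≗to∘g x = cong (B.to ∘ g) (A.strictlyInverseʳ x)

  G-surj : StrictlySurjective _≡_ G
  G-surj k with x , gx≡from-k ← g-surj (B.from k) = A.to x , (begin
    G (A.to x)      ≡⟨ G∘to≗to∘g x ⟩
    B.to (g x)      ≡⟨ cong B.to gx≡from-k ⟩
    B.to (B.from k) ≡⟨ B.strictlyInverseˡ k ⟩
    k               ∎)

  G-injective : Injective _≡_ _≡_ G
  G-injective = strictlySurjective⇒injective G-surj

Elem-suc : ∀ {n b} {S : Subset n} → Elem S → Elem (b ∷ S)
Elem-suc (x , x∈S) = suc x , x∈S

Elem→Fin : ∀ {n} (S : Subset n) → Elem S → Fin ∣ S ∣
Elem→Fin (inside ∷ S)  (zero , _)      = zero
Elem→Fin (inside ∷ S)  (suc x , x∈S)   = suc (Elem→Fin S (x , x∈S))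
Elem→Fin (outside ∷ S) (suc x , x∈S)   = Elem→Fin S (x , x∈S)

Fin→Elem : ∀ {n} (S : Subset n) → Fin ∣ S ∣ → Elem S
Fin→Elem (inside ∷ S)  zero    = zero , tt
Fin→Elem (inside ∷ S)  (suc k) = Elem-suc (Fin→Elem S k)
Fin→Elem (outside ∷ S) k       = Elem-suc (Fin→Elem S k)

Elem→Fin∘Fin→Elem : ∀ {n} (S : Subset n) → StrictlyInverseˡ _≡_ (Elem→Fin S) (Fin→Elem S)
Elem→Fin∘Fin→Elem (inside ∷ S)  zero    = refl
Elem→Fin∘Fin→Elem (inside ∷ S)  (suc k) = cong suc (Elem→Fin∘Fin→Elem S k)
Elem→Fin∘Fin→Elem (outside ∷ S) k       = Elem→Fin∘Fin→Elem S k

Fin→Elem∘Elem→Fin : ∀ {n} (S : Subset n) → StrictlyInverseʳ _≡_ (Elem→Fin S) (Fin→Elem S)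
Fin→Elem∘Elem→Fin (inside ∷ S)  (zero , _)    = refl
Fin→Elem∘Elem→Fin (inside ∷ S)  (suc x , x∈S) = cong Elem-suc (Fin→Elem∘Elem→Fin S (x , x∈S))
Fin→Elem∘Elem→Fin (outside ∷ S) (suc x , x∈S) = cong Elem-suc (Fin→Elem∘Elem→Fin S (x , x∈S))

Elem↔Fin : ∀ {n} (S : Subset n) → Elem S ↔ Fin ∣ S ∣
Elem↔Fin S = mk↔ₛ′ (Elem→Fin S) (Fin→Elem S) (Elem→Fin∘Fin→Elem S) (Fin→Elem∘Elem→Fin S)

surjective⇒bijective-Elem : ∀ {n} (S S̄ : Subset n) → ∣ S ∣ ≡ ∣ S̄ ∣ → {g : Elem S → Elem S̄} →
  Surjective _≡_ _≡_ g → Bijective _≡_ _≡_ g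
surjective⇒bijective-Elem S S̄ ∣S∣≡∣S̄∣ g-surj =
  strictlySurjective⇒injective-↔Fin (Elem↔Fin S) S̄↔Fin∣S∣ (surjective⇒strictlySurjective g-surj) , g-surj
  where
  S̄↔Fin∣S∣ : Elem S̄ ↔ Fin ∣ S ∣
  S̄↔Fin∣S∣ = subst (λ k → Elem S̄ ↔ Fin k) (sym ∣S∣≡∣S̄∣) (Elem↔Fin S̄)

lemma4 : (q : ℕ) → IsPrimePower q → (F : FiniteField q) → let open FiniteField F in
    (S S̄ : Subset q) → ∣ S ∣ ≡ ∣ S̄ ∣ →
    (f : Fin q → Fin q) (g : Elem S → Elem S̄)
    (λ' : Fin q → Elem S) (λ̄ : Fin q → Elem S̄) →
    Surjective _≡_ _≡_ λ' → Surjective _≡_ _≡_ λ̄ →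
    (∀ x → λ̄ (f x) ≡ g (λ' x)) →
    (f₁ : Poly) (h : Elem S → Fin q) →
    (∀ x → f x ≡ eval f₁ x + h (λ' x)) →
    Bijective _≡_ _≡_ f →
    (φ φ̄ : Poly) →
    Bijective _≡_ _≡_ (λ x → eval φ (eval f₁ x) + eval φ̄ (proj₁ (λ' x))) →
    Bijective _≡_ _≡_ g ×
    ((g⁻¹ : Elem S̄ → Elem S) →
     (∀ y → g (g⁻¹ y) ≡ y) → (∀ y → g⁻¹ (g y) ≡ y) →
     (Ψ⁻¹ : Fin q → Fin q) →
     (∀ x → eval φ (eval f₁ (Ψ⁻¹ x)) + eval φ̄ (proj₁ (λ' (Ψ⁻¹ x))) ≡ x) →
     (∀ x → Ψ⁻¹ (eval φ (eval f₁ x) + eval φ̄ (proj₁ (λ' x))) ≡ x) →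
     let f⁻¹ = λ x → Ψ⁻¹ (eval φ (x - h (g⁻¹ (λ̄ x))) + eval φ̄ (proj₁ (g⁻¹ (λ̄ x)))) in
     (∀ x → f (f⁻¹ x) ≡ x) × (∀ x → f⁻¹ (f x) ≡ x))
lemma4 q _ F S S̄ ∣S∣≡∣S̄∣ f g λ' λ̄ _ λ̄-surj λ̄∘f≗g∘λ' f₁ h f≗f₁+h∘λ' (_ , f-surj) φ φ̄ _ =
  surjective⇒bijective-Elem S S̄ ∣S∣≡∣S̄∣ (strictlySurjective⇒surjective g-surj) ,
  λ g⁻¹ _ g⁻¹∘g≗id Ψ⁻¹ _ Ψ⁻¹∘Ψ≗id →
    let open LeftInverse g⁻¹ g⁻¹∘g≗id Ψ⁻¹ Ψ⁻¹∘Ψ≗id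
    in strictlyInverseʳ⇒strictlyInverseˡ (surjective⇒strictlySurjective f-surj) f⁻¹∘f≗id , f⁻¹∘f≗id
  where
  open FiniteField F

  g-surj : StrictlySurjective _≡_ g
  g-surj y with surjective⇒strictlySurjective λ̄-surj y
  ... | z , refl with surjective⇒strictlySurjective f-surj z
  ... | x , refl = λ' x , sym (λ̄∘f≗g∘λ' x)

  ring : CommutativeRing _ _
  ring = record { isCommutativeRing = isCommutativeRing }

  open GroupProperties (CommutativeRing.+-group ring) using (//-rightDividesʳ)

  f-h∘λ'≗f₁ : ∀ x → f x - h (λ' x) ≡ eval f₁ x
  f-h∘λ'≗f₁ x = trans (cong (_- h (λ' x)) (f≗f₁+h∘λ' x)) (//-rightDividesʳ (h (λ' x)) (eval f₁ x))

  module LeftInverse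
    (g⁻¹ : Elem S̄ → Elem S) (g⁻¹∘g≗id : ∀ s → g⁻¹ (g s) ≡ s) (Ψ⁻¹ : Fin q → Fin q)
    (Ψ⁻¹∘Ψ≗id : ∀ x → Ψ⁻¹ (eval φ (eval f₁ x) + eval φ̄ (proj₁ (λ' x))) ≡ x)
    where

    f⁻¹ : Fin q → Fin q
    f⁻¹ y = Ψ⁻¹ (eval φ (y - h (g⁻¹ (λ̄ y))) + eval φ̄ (proj₁ (g⁻¹ (λ̄ y))))

    g⁻¹∘λ̄∘f≗λ' : ∀ x → g⁻¹ (λ̄ (f x)) ≡ λ' x
    g⁻¹∘λ̄∘f≗λ' x = trans (cong g⁻¹ (λ̄∘f≗g∘λ' x)) (g⁻¹∘g≗id (λ' x))

    f⁻¹∘f≗id : StrictlyInverseʳ _≡_ f f⁻¹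
    f⁻¹∘f≗id x = begin
      f⁻¹ (f x)
        ≡⟨ cong (λ s → Ψ⁻¹ (eval φ (f x - h s) + eval φ̄ (proj₁ s))) (g⁻¹∘λ̄∘f≗λ' x) ⟩
      Ψ⁻¹ (eval φ (f x - h (λ' x)) + eval φ̄ (proj₁ (λ' x)))
        ≡⟨ cong (λ y → Ψ⁻¹ (eval φ y + eval φ̄ (proj₁ (λ' x)))) (f-h∘λ'≗f₁ x) ⟩
      Ψ⁻¹ (eval φ (eval f₁ x) + eval φ̄ (proj₁ (λ' x)))
        ≡⟨ Ψ⁻¹∘Ψ≗id x ⟩
      x ∎
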